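{- Let $m>1$ and $n$ be integers. (i) If $3\nmid m$, then $$\left\lfloor\frac{15n-1}{m}\right\rfloor+\left\lfloor\frac{2}{m}\right\rfloor+\left\lfloor\frac{4n}{m}\right\rfloor\ \geqslant\ \left\lfloor\frac{12n+2}{m}\right\rfloor+\left\lfloor\frac{2n}{m}\right\rfloor+\left\lfloor\frac{5n-1}{m}\right\rfloor.$$ (ii) If $5\nmid m$, then $$\left\lfloor\frac{15n-1}{m}\right\rfloor+\left\lfloor\frac{2n}{m}\right\rfloor\ \geqslant\ \left\lfloor\frac{10n+1}{m}\right\rfloor+\left\lfloor\frac{4n}{m}\right\rfloor+\left\lfloor\frac{3n-1}{m}\right\rfloor.$$ -}

module Defs where

open import Data.Integer.Base using (ℤ; _/ℕ_)
open import Data.Nat.Base using (ℕ; NonZero)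

-- ⌊ a / m ⌋ for a positive natural divisor m (floor division).
-- For positive divisors, stdlib's _/ℕ_ is Euclidean division, which agrees with floor.
⌊_/_⌋ : ℤ → (m : ℕ) → .{{NonZero m}} → ℤ
⌊ a / m ⌋ = a /ℕ m

module Submission where

-- Write n = r + q·m with 1 ≤ r ≤ m.  Every term ⌊(c·n + d)/m⌋ equals ⌊(c·r + d)/m⌋ + c·q,
-- and the coefficients c add up to the same number on both sides (19 in (i), 17 in (ii)),
-- so it suffices to prove the inequalities in ℕ for 1 ≤ r ≤ m.
--
-- For m ≤ 10 this is a finite computation.  For m ≥ 11 every coefficient k divides 60, so
-- ⌊k·r/m⌋ = ⌊j/(60/k)⌋ with j = ⌊60r/m⌋ ≤ 60, and the inequality between the unshifted
-- terms ⌊k·r/m⌋ is a finite check in j.  The shifts ±1, +2 change a term by at most one,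
-- and only when a multiple of m lies in the shifted range.  If m ∣ 15r, then m ∣ 5r (resp.
-- m ∣ 3r) because 3 ∤ m (resp. 5 ∤ m), which compensates the loss on the right.  If a
-- multiple of m lies just above 12r (resp. 10r), then j + 1 is forced into a residue class
-- where the finite check is strict.

module Natural where

  open import Data.Nat.Base
  open import Data.Nat.Properties
  open import Data.Nat.DivMod
  open import Data.Nat.Divisibility
    using (_∣_; _∣?_; divides; ∣m+n∣m⇒∣n; >⇒∤; ∣m⇒∣m*n; ∣n⇒∣m*n; m∣m*n; *-cancelˡ-∣)
  open import Data.Nat.Coprimality using (Coprime; coprime-divisor)
  open import Data.Nat.Primality using (Prime; prime?; prime⇒irreducible)
  open import Data.Nat.Tactic.RingSolver using (solve-∀)
  open import Data.Bool.Base using (T)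
  open import Data.Empty using (⊥-elim)
  open import Data.Sum using (inj₁; inj₂)
  open import Data.Product using (_,_)
  open import Function using (_∘_)
  open import Relation.Binary.PropositionalEquality
  open import Relation.Nullary using (¬_; yes; no)
  open import Relation.Nullary.Decidable using (from-yes; _→-dec_; ¬?)

  ∤-offset : ∀ {d x} e .{{_ : NonZero e}} → d ∣ x → e < d → ¬ d ∣ x + e
  ∤-offset e d∣x e<d d∣x+e = >⇒∤ e<d (∣m+n∣m⇒∣n d∣x+e d∣x)

  prime-∤-cancel : ∀ {p m x} → Prime p → ¬ p ∣ m → m ∣ p * x → m ∣ x
  prime-∤-cancel {p} {m} p-prime p∤m = coprime-divisor m⊥p
    where
    m⊥p : Coprime m p
    m⊥p (d∣m , d∣p) with prime⇒irreducible p-prime d∣p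
    ... | inj₁ d≡1  = d≡1
    ... | inj₂ refl = ⊥-elim (p∤m d∣m)

  module _ (m : ℕ) .{{_ : NonZero m}} where

    /-unique : ∀ {y q} → q * m ≤ y → y < suc q * m → y / m ≡ q
    /-unique {y} {q} lo hi =
      ≤-antisym (s≤s⁻¹ (m<n*o⇒m/o<n hi)) (subst (_≤ y / m) (m*n/n≡m q m) (/-monoˡ-≤ m lo))

    <-next-multiple : ∀ y → y < suc (y / m) * m
    <-next-multiple y =
      subst (_< suc (y / m) * m) (sym (m≡m%n+[m/n]*n y m)) (+-monoˡ-< (y / m * m) (m%n<n y m))

    /-pred-nondiv : ∀ {x} → ¬ m ∣ x → (x ∸ 1) / m ≡ x / m
    /-pred-nondiv {x} m∤x = /-unique below above
      where
      below : x / m * m ≤ x ∸ 1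
      below = <⇒≤pred (≤∧≢⇒< (m/n*n≤m x m) (λ eq → m∤x (divides (x / m) (sym eq))))
      above : x ∸ 1 < suc (x / m) * m
      above = ≤-<-trans (m∸n≤m x 1) (<-next-multiple x)

    /-no-multiple : ∀ x e → (∀ {i} → i < e → ¬ m ∣ x + suc i) → (x + e) / m ≡ x / m
    /-no-multiple x zero    _    = cong (_/ m) (+-identityʳ x)
    /-no-multiple x (suc e) none = begin
      (x + suc e) / m ≡⟨ cong (_/ m) (+-suc x e) ⟩
      suc (x + e) / m ≡⟨ /-pred-nondiv (subst (¬_ ∘ (m ∣_)) (+-suc x e) (none ≤-refl)) ⟨
      (x + e) / m     ≡⟨ /-no-multiple x e (none ∘ m≤n⇒m≤1+n) ⟩
      x / m           ∎
      where open ≡-Reasoning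

    /-+-≤ : ∀ x {e} → e ≤ m → (x + e) / m ≤ suc (x / m)
    /-+-≤ x {e} e≤m = begin
      (x + e) / m   ≤⟨ /-monoˡ-≤ m (+-monoʳ-≤ x e≤m) ⟩
      (x + m) / m   ≡⟨ +-distrib-/-∣ʳ x (divides 1 (sym (*-identityˡ m))) ⟩
      x / m + m / m ≡⟨ cong (x / m +_) (n/n≡1 m) ⟩
      x / m + 1     ≡⟨ +-comm (x / m) 1 ⟩
      suc (x / m)   ∎
      where open ≤-Reasoning

    /-below-multiple : ∀ {x y e} d → m ∣ x → d * x ≡ y + e → 1 ≤ e → e ≤ m →
                       suc (y / m) ≡ d * (x / m)
    /-below-multiple {x} {y} {e} d m∣x dx≡y+e 1≤e e≤m = ≤-antisym upper lower
      where
      k = d * (x / m)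
      y+e≡k*m : y + e ≡ k * m
      y+e≡k*m = begin
        y + e           ≡⟨ dx≡y+e ⟨
        d * x           ≡⟨ cong (d *_) (m/n*n≡m m∣x) ⟨
        d * (x / m * m) ≡⟨ *-assoc d (x / m) m ⟨
        k * m           ∎
        where open ≡-Reasoning
      upper : suc (y / m) ≤ k
      upper = m<n*o⇒m/o<n (subst (y <_) y+e≡k*m (m<m+n y 1≤e))
      lower : k ≤ suc (y / m)
      lower = subst (_≤ suc (y / m)) (trans (cong (_/ m) y+e≡k*m) (m*n/n≡m k m)) (/-+-≤ y e≤m)

    /-pred-div : ∀ {x} → m ∣ x → 1 ≤ x → suc ((x ∸ 1) / m) ≡ x / m
    /-pred-div {x} m∣x 1≤x =
      trans (/-below-multiple 1 m∣x (trans (*-identityˡ x) (sym (m∸n+n≡m 1≤x))) ≤-refl (>-nonZero⁻¹ m))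
            (*-identityˡ (x / m))

    /-rescale : ∀ d .{{_ : NonZero d}} x → x / m ≡ d * x / m / d
    /-rescale d x = begin
      x / m             ≡⟨ m*n/m*o≡n/o d x m ⟨
      d * x / (d * m)   ≡⟨ /-congʳ (*-comm d m) ⟩
      d * x / (m * d)   ≡⟨ m/n/o≡m/[n*o] (d * x) m d ⟨
      d * x / m / d     ∎
      where
      open ≡-Reasoning
      instance
        dm≢0 : NonZero (d * m)
        dm≢0 = m*n≢0 d m
        md≢0 : NonZero (m * d)
        md≢0 = m*n≢0 m d

    quotient-∤ : ∀ {c x} → m ∣ x → ¬ c ∣ x → ¬ c ∣ x / m
    quotient-∤ m∣x c∤x c∣q = c∤x (subst (_ ∣_) (m/n*n≡m m∣x) (∣m⇒∣m*n m c∣q))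

  leftI rightI leftII rightII : (m : ℕ) .{{_ : NonZero m}} → ℕ → ℕ
  leftI   m r = (12 * r + 2) / m + 2 * r / m + (5 * r ∸ 1) / m
  rightI  m r = (15 * r ∸ 1) / m + 2 / m + 4 * r / m
  leftII  m r = (10 * r + 1) / m + 4 * r / m + (3 * r ∸ 1) / m
  rightII m r = (15 * r ∸ 1) / m + 2 * r / m

  -- At resolution 60 the unshifted quotients k·r/m become ⌊j/(60/k)⌋, j = ⌊60r/m⌋ ≤ 60,
  -- and the inequalities between them are checked for every such j.
  lhsI rhsI lhsII rhsII : ℕ → ℕ
  lhsI  j = j / 5 + j / 30 + j / 12
  rhsI  j = j / 4 + j / 15
  lhsII j = j / 6 + j / 15 + j / 20
  rhsII j = j / 4 + j / 30

  baseI : ∀ {j} → j < 61 → lhsI j ≤ rhsI j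
  baseI = from-yes (allUpTo? (λ j → lhsI j ≤? rhsI j) 61)

  strictI : ∀ {j} → j < 61 → 5 ∣ suc j → ¬ 15 ∣ suc j → ¬ 20 ∣ suc j → suc (lhsI j) ≤ rhsI j
  strictI = from-yes (allUpTo? (λ j →
    5 ∣? suc j →-dec ¬? (15 ∣? suc j) →-dec ¬? (20 ∣? suc j) →-dec suc (lhsI j) ≤? rhsI j) 61)

  baseII : ∀ {j} → j < 61 → lhsII j ≤ rhsII j
  baseII = from-yes (allUpTo? (λ j → lhsII j ≤? rhsII j) 61)

  strictII : ∀ {j} → j < 61 → 6 ∣ suc j → ¬ 12 ∣ suc j → suc (lhsII j) ≤ rhsII j
  strictII = from-yes (allUpTo? (λ j →
    6 ∣? suc j →-dec ¬? (12 ∣? suc j) →-dec suc (lhsII j) ≤? rhsII j) 61)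

  module Resolution60 (m : ℕ) .{{_ : NonZero m}} (11≤m : 11 ≤ m)
                      (r : ℕ) (1≤r : 1 ≤ r) (r≤m : r ≤ m) where

    j : ℕ
    j = 60 * r / m

    j<61 : j < 61
    j<61 = m<n*o⇒m/o<n (≤-<-trans (*-monoʳ-≤ 60 r≤m) (*-monoˡ-< m (≤-refl {61})))

    slice : ∀ k d .{{_ : NonZero d}} → d * k ≡ 60 → k * r / m ≡ j / d
    slice k d dk≡60 = trans (/-rescale m d (k * r)) (cong (λ x → x / m / d) d*[k*r]≡60*r)
      where
      open ≡-Reasoning
      d*[k*r]≡60*r : d * (k * r) ≡ 60 * r
      d*[k*r]≡60*r = begin
        d * (k * r) ≡⟨ *-assoc d k r ⟨
        d * k * r   ≡⟨ cong (_* r) dk≡60 ⟩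
        60 * r      ∎

    1≤k*r : ∀ k .{{_ : NonZero k}} → 1 ≤ k * r
    1≤k*r k = ≤-trans 1≤r (m≤n*m r k)

    <m : ∀ {e} → e < 11 → e < m
    <m e<11 = <-≤-trans e<11 11≤m

    lit<m : ∀ e → T (e <ᵇ 11) → e < m
    lit<m e e<11 = <m (<ᵇ⇒< e 11 e<11)

    last-nondiv : ¬ m ∣ 15 * r → (15 * r ∸ 1) / m ≡ 15 * r / m
    last-nondiv = /-pred-nondiv m

    last-div : m ∣ 15 * r → suc ((15 * r ∸ 1) / m) ≡ 15 * r / m
    last-div m∣15r = /-pred-div m m∣15r (1≤k*r 15)

  scaleI : ∀ r i → 5 * (12 * r + suc i) ≡ 60 * r + 5 * suc i
  scaleI = solve-∀

  spreadI : ∀ r i → 5 * (12 * r + suc i) ≡ 4 * (15 * r) + 5 * suc i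
  spreadI = solve-∀

  module LargeI (m : ℕ) .{{_ : NonZero m}} (11≤m : 11 ≤ m) (3∤m : ¬ 3 ∣ m)
                (r : ℕ) (1≤r : 1 ≤ r) (r≤m : r ≤ m) where

    open Resolution60 m 11≤m r 1≤r r≤m

    lhs≡ : 12 * r / m + 2 * r / m + 5 * r / m ≡ lhsI j
    lhs≡ = cong₂ _+_ (cong₂ _+_ (slice 12 5 refl) (slice 2 30 refl)) (slice 5 12 refl)

    rhs≡ : 15 * r / m + 4 * r / m ≡ rhsI j
    rhs≡ = cong₂ _+_ (slice 15 4 refl) (slice 4 15 refl)

    base : 12 * r / m + 2 * r / m + 5 * r / m ≤ 15 * r / m + 4 * r / m
    base = subst₂ _≤_ (sym lhs≡) (sym rhs≡) (baseI j<61)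

    -- If 12r + e = q·m with e ∈ {1, 2}, then j + 1 = 5q with 3 ∤ q and 4 ∤ q,
    -- where the base inequality is strict.
    strict : ∀ {i} → i < 2 → m ∣ 12 * r + suc i →
             suc (12 * r / m + 2 * r / m + 5 * r / m) ≤ 15 * r / m + 4 * r / m
    strict {i} i<2 m∣x = subst₂ _≤_ (sym (cong suc lhs≡)) (sym rhs≡)
      (strictI j<61 5∣j+1 (λ 15∣ → 3∤q (*-cancelˡ-∣ 5 (subst (15 ∣_) j+1≡5q 15∣)))
                          (λ 20∣ → 4∤q (*-cancelˡ-∣ 5 (subst (20 ∣_) j+1≡5q 20∣))))
      where
      q = (12 * r + suc i) / m
      j+1≡5q : suc j ≡ 5 * q
      j+1≡5q = /-below-multiple m 5 m∣x (scaleI r i) (s≤s z≤n) (<⇒≤ (<m (s≤s (*-monoʳ-≤ 5 i<2))))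
      5∣j+1 : 5 ∣ suc j
      5∣j+1 = subst (5 ∣_) (sym j+1≡5q) (m∣m*n q)
      3∤q : ¬ 3 ∣ q
      3∤q = quotient-∤ m m∣x (∤-offset (suc i) (∣m⇒∣m*n r (divides 4 refl)) (s≤s i<2))
      4∤q : ¬ 4 ∣ q
      4∤q = quotient-∤ m m∣x (∤-offset (suc i) (∣m⇒∣m*n r (divides 3 refl)) (s≤s (m≤n⇒m≤1+n i<2)))

    5r-div : m ∣ 15 * r → m ∣ 5 * r
    5r-div m∣15r = prime-∤-cancel (from-yes (prime? 3)) 3∤m (subst (m ∣_) (*-assoc 3 5 r) m∣15r)

    clear : m ∣ 15 * r → ∀ {i} → i < 2 → ¬ m ∣ 12 * r + suc i
    clear m∣15r {i} i<2 m∣x = ∤-offset (5 * suc i) (∣n⇒∣m*n 4 m∣15r) (<m (s≤s (*-monoʳ-≤ 5 i<2)))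
      (subst (m ∣_) (spreadI r i) (∣n⇒∣m*n 5 m∣x))

    first-bound : (12 * r + 2) / m + 2 * r / m + 5 * r / m ≤ 15 * r / m + 4 * r / m
    first-bound with anyUpTo? (λ i → m ∣? 12 * r + suc i) 2
    ... | yes (i , i<2 , m∣x) =
      ≤-trans (+-monoˡ-≤ (5 * r / m) (+-monoˡ-≤ (2 * r / m) (/-+-≤ m (12 * r) (<⇒≤ (lit<m 2 _)))))
              (strict i<2 m∣x)
    ... | no none =
      subst (λ x → x + 2 * r / m + 5 * r / m ≤ 15 * r / m + 4 * r / m)
            (sym (/-no-multiple m (12 * r) 2 (λ i<2 m∣x → none (_ , i<2 , m∣x)))) base

    drop-2/m : ∀ x → x + 2 / m + 4 * r / m ≡ x + 4 * r / m
    drop-2/m x = trans (cong (λ z → x + z + 4 * r / m) (m<n⇒m/n≡0 (lit<m 2 _)))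
                       (cong (_+ 4 * r / m) (+-identityʳ x))

    inequality : leftI m r ≤ rightI m r
    inequality with m ∣? 15 * r
    ... | yes m∣15r = s≤s⁻¹ (begin
      suc ((12 * r + 2) / m + 2 * r / m + (5 * r ∸ 1) / m)
        ≡⟨ +-suc ((12 * r + 2) / m + 2 * r / m) ((5 * r ∸ 1) / m) ⟨
      (12 * r + 2) / m + 2 * r / m + suc ((5 * r ∸ 1) / m)
        ≡⟨ cong₂ (λ x y → x + 2 * r / m + y) (/-no-multiple m (12 * r) 2 (clear m∣15r))
                                              (/-pred-div m (5r-div m∣15r) (1≤k*r 5)) ⟩
      12 * r / m + 2 * r / m + 5 * r / m
        ≤⟨ base ⟩
      15 * r / m + 4 * r / m
        ≡⟨ cong (_+ 4 * r / m) (last-div m∣15r) ⟨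
      suc ((15 * r ∸ 1) / m + 4 * r / m)
        ≡⟨ cong suc (drop-2/m ((15 * r ∸ 1) / m)) ⟨
      suc ((15 * r ∸ 1) / m + 2 / m + 4 * r / m) ∎)
      where open ≤-Reasoning
    ... | no m∤15r = begin
      (12 * r + 2) / m + 2 * r / m + (5 * r ∸ 1) / m
        ≤⟨ +-monoʳ-≤ ((12 * r + 2) / m + 2 * r / m) (/-monoˡ-≤ m (m∸n≤m (5 * r) 1)) ⟩
      (12 * r + 2) / m + 2 * r / m + 5 * r / m
        ≤⟨ first-bound ⟩
      15 * r / m + 4 * r / m
        ≡⟨ cong (_+ 4 * r / m) (last-nondiv m∤15r) ⟨
      (15 * r ∸ 1) / m + 4 * r / m
        ≡⟨ drop-2/m ((15 * r ∸ 1) / m) ⟨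
      (15 * r ∸ 1) / m + 2 / m + 4 * r / m ∎
      where open ≤-Reasoning

  scaleII : ∀ r → 6 * (10 * r + 1) ≡ 60 * r + 6
  scaleII = solve-∀

  spreadII : ∀ r → 3 * (10 * r + 1) ≡ 2 * (15 * r) + 3
  spreadII = solve-∀

  module LargeII (m : ℕ) .{{_ : NonZero m}} (11≤m : 11 ≤ m) (5∤m : ¬ 5 ∣ m)
                 (r : ℕ) (1≤r : 1 ≤ r) (r≤m : r ≤ m) where

    open Resolution60 m 11≤m r 1≤r r≤m

    lhs≡ : 10 * r / m + 4 * r / m + 3 * r / m ≡ lhsII j
    lhs≡ = cong₂ _+_ (cong₂ _+_ (slice 10 6 refl) (slice 4 15 refl)) (slice 3 20 refl)

    rhs≡ : 15 * r / m + 2 * r / m ≡ rhsII j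
    rhs≡ = cong₂ _+_ (slice 15 4 refl) (slice 2 30 refl)

    base : 10 * r / m + 4 * r / m + 3 * r / m ≤ 15 * r / m + 2 * r / m
    base = subst₂ _≤_ (sym lhs≡) (sym rhs≡) (baseII j<61)

    -- If 10r + 1 = q·m, then j + 1 = 6q with q odd, where the base inequality is strict.
    strict : m ∣ 10 * r + 1 → suc (10 * r / m + 4 * r / m + 3 * r / m) ≤ 15 * r / m + 2 * r / m
    strict m∣x = subst₂ _≤_ (sym (cong suc lhs≡)) (sym rhs≡)
      (strictII j<61 6∣j+1 (λ 12∣ → 2∤q (*-cancelˡ-∣ 6 (subst (12 ∣_) j+1≡6q 12∣))))
      where
      q = (10 * r + 1) / m
      j+1≡6q : suc j ≡ 6 * q
      j+1≡6q = /-below-multiple m 6 m∣x (scaleII r) (s≤s z≤n) (<⇒≤ (lit<m 6 _))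
      6∣j+1 : 6 ∣ suc j
      6∣j+1 = subst (6 ∣_) (sym j+1≡6q) (m∣m*n q)
      2∤q : ¬ 2 ∣ q
      2∤q = quotient-∤ m m∣x (∤-offset 1 (∣m⇒∣m*n r (divides 5 refl)) (s≤s (s≤s z≤n)))

    3r-div : m ∣ 15 * r → m ∣ 3 * r
    3r-div m∣15r = prime-∤-cancel (from-yes (prime? 5)) 5∤m (subst (m ∣_) (*-assoc 5 3 r) m∣15r)

    clear : m ∣ 15 * r → ¬ m ∣ 10 * r + 1
    clear m∣15r m∣x = ∤-offset 3 (∣n⇒∣m*n 2 m∣15r) (lit<m 3 _) (subst (m ∣_) (spreadII r) (∣n⇒∣m*n 3 m∣x))

    no-multiple : ¬ m ∣ 10 * r + 1 → (10 * r + 1) / m ≡ 10 * r / m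
    no-multiple m∤x = /-no-multiple m (10 * r) 1 λ { {zero} _ → m∤x ; {suc _} (s≤s ()) }

    first-bound : (10 * r + 1) / m + 4 * r / m + 3 * r / m ≤ 15 * r / m + 2 * r / m
    first-bound with m ∣? 10 * r + 1
    ... | yes m∣x =
      ≤-trans (+-monoˡ-≤ (3 * r / m) (+-monoˡ-≤ (4 * r / m) (/-+-≤ m (10 * r) (<⇒≤ (lit<m 1 _)))))
              (strict m∣x)
    ... | no m∤x =
      subst (λ x → x + 4 * r / m + 3 * r / m ≤ 15 * r / m + 2 * r / m) (sym (no-multiple m∤x)) base

    inequality : leftII m r ≤ rightII m r
    inequality with m ∣? 15 * r
    ... | yes m∣15r = s≤s⁻¹ (begin
      suc ((10 * r + 1) / m + 4 * r / m + (3 * r ∸ 1) / m)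
        ≡⟨ +-suc ((10 * r + 1) / m + 4 * r / m) ((3 * r ∸ 1) / m) ⟨
      (10 * r + 1) / m + 4 * r / m + suc ((3 * r ∸ 1) / m)
        ≡⟨ cong₂ (λ x y → x + 4 * r / m + y) (no-multiple (clear m∣15r))
                                              (/-pred-div m (3r-div m∣15r) (1≤k*r 3)) ⟩
      10 * r / m + 4 * r / m + 3 * r / m
        ≤⟨ base ⟩
      15 * r / m + 2 * r / m
        ≡⟨ cong (_+ 2 * r / m) (last-div m∣15r) ⟨
      suc ((15 * r ∸ 1) / m + 2 * r / m) ∎)
      where open ≤-Reasoning
    ... | no m∤15r = begin
      (10 * r + 1) / m + 4 * r / m + (3 * r ∸ 1) / m
        ≤⟨ +-monoʳ-≤ ((10 * r + 1) / m + 4 * r / m) (/-monoˡ-≤ m (m∸n≤m (3 * r) 1)) ⟩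
      (10 * r + 1) / m + 4 * r / m + 3 * r / m
        ≤⟨ first-bound ⟩
      15 * r / m + 2 * r / m
        ≡⟨ cong (_+ 2 * r / m) (last-nondiv m∤15r) ⟨
      (15 * r ∸ 1) / m + 2 * r / m ∎
      where open ≤-Reasoning

  smallI : ∀ {k} → k < 9 → ¬ 3 ∣ 2 + k → ∀ {ρ} → ρ < 2 + k → leftI (2 + k) (suc ρ) ≤ rightI (2 + k) (suc ρ)
  smallI = from-yes (allUpTo? (λ k → ¬? (3 ∣? 2 + k) →-dec
    allUpTo? (λ ρ → leftI (2 + k) (suc ρ) ≤? rightI (2 + k) (suc ρ)) (2 + k)) 9)

  smallII : ∀ {k} → k < 9 → ¬ 5 ∣ 2 + k → ∀ {ρ} → ρ < 2 + k → leftII (2 + k) (suc ρ) ≤ rightII (2 + k) (suc ρ)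
  smallII = from-yes (allUpTo? (λ k → ¬? (5 ∣? 2 + k) →-dec
    allUpTo? (λ ρ → leftII (2 + k) (suc ρ) ≤? rightII (2 + k) (suc ρ)) (2 + k)) 9)

  inequalityI : ∀ m .{{_ : NonZero m}} → 1 < m → ¬ 3 ∣ m → ∀ r → 1 ≤ r → r ≤ m → leftI m r ≤ rightI m r
  inequalityI 1 (s≤s ()) _ _ _ _
  inequalityI (suc (suc k)) _ 3∤m (suc ρ) _ r≤m with k <? 9
  ... | yes k<9 = smallI k<9 3∤m r≤m
  ... | no  k≮9 = LargeI.inequality (2 + k) (s≤s (s≤s (≮⇒≥ k≮9))) 3∤m (suc ρ) (s≤s z≤n) r≤m

  inequalityII : ∀ m .{{_ : NonZero m}} → 1 < m → ¬ 5 ∣ m → ∀ r → 1 ≤ r → r ≤ m → leftII m r ≤ rightII m r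
  inequalityII 1 (s≤s ()) _ _ _ _
  inequalityII (suc (suc k)) _ 5∤m (suc ρ) _ r≤m with k <? 9
  ... | yes k<9 = smallII k<9 5∤m r≤m
  ... | no  k≮9 = LargeII.inequality (2 + k) (s≤s (s≤s (≮⇒≥ k≮9))) 5∤m (suc ρ) (s≤s z≤n) r≤m

open import Defs
open import Data.Nat.Base using (ℕ; NonZero)
open import Data.Integer.Base using (ℤ; +_; _+_; _-_; _*_; _≤_)
open import Data.Nat.Divisibility using (_∣_)
open import Data.Nat.Base as N using ()
open import Data.Product using (_×_)
open import Relation.Nullary using (¬_)

open import Data.Product using (_,_)
open import Data.Integer.Base using (_<_; _/ℕ_; _%ℕ_; -_; +≤+; suc)
open import Data.Integer.Properties
  using (≤-antisym; ≤-<-trans; +-monoˡ-≤; +-monoˡ-<; *-cancelʳ-<-nonNeg;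
         i<j⇒i≤pred[j]; pred-suc; *-distribʳ-+)
open import Data.Integer.DivMod using (a≡a%ℕn+[a/ℕn]*n; n%ℕd<d; [n/ℕd]*d≤n; n<s[n/ℕd]*d)
open import Data.Integer.Tactic.RingSolver using (solve-∀)
open import Relation.Binary.PropositionalEquality

open Natural using (leftI; rightI; leftII; rightII; inequalityI; inequalityII)

suc-shift : ∀ q k c → (+ 1 + (q + k)) * c ≡ (+ 1 + q) * c + k * c
suc-shift = solve-∀

distribute : ∀ c r q m d → c * (r + q * m) + d ≡ (c * r + d) + c * q * m
distribute = solve-∀

distribute₀ : ∀ c r q m → c * (r + q * m) ≡ c * r + c * q * m
distribute₀ = solve-∀

pred-inverse : ∀ n → n ≡ (n - + 1) + + 1
pred-inverse = solve-∀

move-1 : ∀ a b → a + b + + 1 ≡ + 1 + a + b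
move-1 = solve-∀

collectI-left : ∀ a b c q → (a + + 12 * q) + (b + + 2 * q) + (c + + 5 * q) ≡ a + b + c + + 19 * q
collectI-left = solve-∀

collectI-right : ∀ a b c q → (a + + 15 * q) + b + (c + + 4 * q) ≡ a + b + c + + 19 * q
collectI-right = solve-∀

collectII-left : ∀ a b c q → (a + + 10 * q) + (b + + 4 * q) + (c + + 3 * q) ≡ a + b + c + + 17 * q
collectII-left = solve-∀

collectII-right : ∀ a b q → (a + + 15 * q) + (b + + 2 * q) ≡ a + b + + 17 * q
collectII-right = solve-∀

module _ (m : ℕ) .{{_ : NonZero m}} where

  quotient-bound : ∀ {a q q'} → q * + m ≤ a → a < suc q' * + m → q ≤ q'
  quotient-bound {q' = q'} lo hi =
    subst (_ ≤_) (pred-suc q') (i<j⇒i≤pred[j] (*-cancelʳ-<-nonNeg {j = suc q'} (+ m) (≤-<-trans lo hi)))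

  /ℕ-unique : ∀ {a q} → q * + m ≤ a → a < suc q * + m → a /ℕ m ≡ q
  /ℕ-unique {a} lo hi =
    ≤-antisym (quotient-bound ([n/ℕd]*d≤n a m) hi) (quotient-bound lo (n<s[n/ℕd]*d a m))

  /ℕ-shift : ∀ a k → (a + k * + m) /ℕ m ≡ a /ℕ m + k
  /ℕ-shift a k = /ℕ-unique lower upper
    where
    q = a /ℕ m
    lower : (q + k) * + m ≤ a + k * + m
    lower = subst (_≤ a + k * + m) (sym (*-distribʳ-+ (+ m) q k)) (+-monoˡ-≤ (k * + m) ([n/ℕd]*d≤n a m))
    upper : a + k * + m < suc (q + k) * + m
    upper = subst (a + k * + m <_) (sym (suc-shift q k (+ m))) (+-monoˡ-< (k * + m) (n<s[n/ℕd]*d a m))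

module Split (m : ℕ) .{{_ : NonZero m}} (n : ℤ) where

  q : ℤ
  q = (n - + 1) /ℕ m

  r : ℕ
  r = N.suc ((n - + 1) %ℕ m)

  1≤r : 1 N.≤ r
  1≤r = N.s≤s N.z≤n

  r≤m : r N.≤ m
  r≤m = n%ℕd<d (n - + 1) m

  n≡r+q*m : n ≡ + r + q * + m
  n≡r+q*m = trans (pred-inverse n)
    (trans (cong (_+ + 1) (a≡a%ℕn+[a/ℕn]*n (n - + 1) m)) (move-1 (+ ((n - + 1) %ℕ m)) (q * + m)))

  term : ∀ c d → ⌊ + c * n + d / m ⌋ ≡ ⌊ + c * + r + d / m ⌋ + + c * q
  term c d = trans (cong (λ x → (+ c * x + d) /ℕ m) n≡r+q*m)
    (trans (cong (_/ℕ m) (distribute (+ c) (+ r) q (+ m) d)) (/ℕ-shift m (+ c * + r + d) (+ c * q)))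

  term₀ : ∀ c → ⌊ + c * n / m ⌋ ≡ ⌊ + c * + r / m ⌋ + + c * q
  term₀ c = trans (cong (λ x → (+ c * x) /ℕ m) n≡r+q*m)
    (trans (cong (_/ℕ m) (distribute₀ (+ c) (+ r) q (+ m))) (/ℕ-shift m (+ c * + r) (+ c * q)))

  splitI-left : ⌊ + 12 * n + + 2 / m ⌋ + ⌊ + 2 * n / m ⌋ + ⌊ + 5 * n - + 1 / m ⌋ ≡ + leftI m r + + 19 * q
  splitI-left = trans (cong₂ _+_ (cong₂ _+_ (term 12 (+ 2)) (term₀ 2)) (term 5 (- + 1)))
    (collectI-left ⌊ + 12 * + r + + 2 / m ⌋ ⌊ + 2 * + r / m ⌋ ⌊ + 5 * + r - + 1 / m ⌋ q)

  splitI-right : ⌊ + 15 * n - + 1 / m ⌋ + ⌊ + 2 / m ⌋ + ⌊ + 4 * n / m ⌋ ≡ + rightI m r + + 19 * q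
  splitI-right = trans (cong₂ _+_ (cong (_+ ⌊ + 2 / m ⌋) (term 15 (- + 1))) (term₀ 4))
    (collectI-right ⌊ + 15 * + r - + 1 / m ⌋ ⌊ + 2 / m ⌋ ⌊ + 4 * + r / m ⌋ q)

  splitII-left : ⌊ + 10 * n + + 1 / m ⌋ + ⌊ + 4 * n / m ⌋ + ⌊ + 3 * n - + 1 / m ⌋ ≡ + leftII m r + + 17 * q
  splitII-left = trans (cong₂ _+_ (cong₂ _+_ (term 10 (+ 1)) (term₀ 4)) (term 3 (- + 1)))
    (collectII-left ⌊ + 10 * + r + + 1 / m ⌋ ⌊ + 4 * + r / m ⌋ ⌊ + 3 * + r - + 1 / m ⌋ q)

  splitII-right : ⌊ + 15 * n - + 1 / m ⌋ + ⌊ + 2 * n / m ⌋ ≡ + rightII m r + + 17 * q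
  splitII-right = trans (cong₂ _+_ (term 15 (- + 1)) (term₀ 2))
    (collectII-right ⌊ + 15 * + r - + 1 / m ⌋ ⌊ + 2 * + r / m ⌋ q)

theorem2p3 : (m : ℕ) .{{_ : NonZero m}} → 1 N.< m → (n : ℤ) →
    ((¬ (3 ∣ m)) →
      ⌊ + 12 * n + + 2 / m ⌋ + ⌊ + 2 * n / m ⌋ + ⌊ + 5 * n - + 1 / m ⌋
        ≤ ⌊ + 15 * n - + 1 / m ⌋ + ⌊ + 2 / m ⌋ + ⌊ + 4 * n / m ⌋)
  × ((¬ (5 ∣ m)) →
      ⌊ + 10 * n + + 1 / m ⌋ + ⌊ + 4 * n / m ⌋ + ⌊ + 3 * n - + 1 / m ⌋
        ≤ ⌊ + 15 * n - + 1 / m ⌋ + ⌊ + 2 * n / m ⌋)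
theorem2p3 m 1<m n =
    (λ 3∤m → subst₂ _≤_ (sym splitI-left) (sym splitI-right)
                        (shift 19 (inequalityI m 1<m 3∤m r 1≤r r≤m)))
  , (λ 5∤m → subst₂ _≤_ (sym splitII-left) (sym splitII-right)
                        (shift 17 (inequalityII m 1<m 5∤m r 1≤r r≤m)))
  where
  open Split m n
  shift : ∀ c {x y} → x N.≤ y → + x + + c * q ≤ + y + + c * q
  shift c x≤y = +-monoˡ-≤ (+ c * q) (+≤+ x≤y)
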